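{- Let $n,k,k'$ be integers with $n\geq k\geq 3$, $k'\geq 1$ and $k-k'\geq 2$, and let $T$ be a tree of order $n$. Then $$Sd_{k-k'}(T)\leq Sr_{k,k'}(T).$$
   Context: All graphs are finite, simple and connected. For a graph $G$ and $S\subseteq V(G)$, the Steiner distance $d_G(S)$ is the minimum number of edges of a connected subgraph of $G$ (equivalently, of a subtree of $G$) whose vertex set contains $S$. For integers $k\geq 2$, $1\leq k'\leq k$, $|V(G)|\geq k$, and a $k'$-subset $S'\subseteq V(G)$, the Steiner $(k,k')$-eccentricity of $S'$ is $\varepsilon_{k,k'}(S';G)=\max\{d_G(S): S'\subseteq S\subseteq V(G),\ |S|=k\}$. The Steiner $k$-eccentricity of a vertex $v$ is $\varepsilon_k(v;G)=\varepsilon_{k,1}(\{v\};G)$. The Steiner $k$-diameter is $Sd_k(G)=\max\{\varepsilon_k(v;G): v\in V(G)\}$, and the Steiner $(k,k')$-radius is $Sr_{k,k'}(G)=\min\{\varepsilon_{k,k'}(S';G): S'\subseteq V(G),\ |S'|=k'\}$. -}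

module Defs where

open import Data.Nat using (ℕ; zero; suc; _+_; _≤_; _<ᵇ_)
open import Data.Bool using (Bool; true; false; if_then_else_; _∧_)
open import Data.Fin using (Fin; toℕ; inject₁; fromℕ) renaming (zero to fzero; suc to fsuc)
open import Data.Fin.Subset using (Subset; _∈_; _⊆_; ∣_∣)
open import Data.List using (List; map; allFin)
open import Data.Nat.ListAction using (sum)
open import Data.Product using (Σ; _×_; ∃)
open import Function.Definitions using (Injective)
open import Relation.Binary.PropositionalEquality using (_≡_)
open import Relation.Nullary using (¬_)

record Graph (n : ℕ) : Set where
  field
    adj   : Fin n → Fin n → Bool
    sym   : ∀ u v → adj u v ≡ true → adj v u ≡ true
    irrefl : ∀ v → adj v v ≡ false
open Graph public

data Walk {n : ℕ} (A : Fin n → Fin n → Bool) : Fin n → Fin n → Set where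
  here : ∀ {u} → Walk A u u
  step : ∀ {u v w} → A u v ≡ true → Walk A v w → Walk A u w

Connected : ∀ {n} → Graph n → Set
Connected G = ∀ u v → Walk (adj G) u v

-- A cycle: distinct vertices f 0, …, f (m+2) (length ≥ 3), consecutive adjacent,
-- and last adjacent to first.
HasCycle : ∀ {n} → Graph n → Set
HasCycle {n} G =
  Σ ℕ λ m → Σ (Fin (suc (suc (suc m))) → Fin n) λ f →
    Injective _≡_ _≡_ f
    × (∀ (i : Fin (suc (suc m))) → adj G (f (inject₁ i)) (f (fsuc i)) ≡ true)
    × (adj G (f (fromℕ (suc (suc m)))) (f fzero) ≡ true)

IsTree : ∀ {n} → Graph n → Set
IsTree G = Connected G × ¬ HasCycle G

edgeCount : ∀ {n} → (Fin n → Fin n → Bool) → ℕ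
edgeCount {n} H =
  sum (map (λ i → sum (map (λ j → if (toℕ i <ᵇ toℕ j) ∧ H i j then 1 else 0) (allFin n))) (allFin n))

record Subgraph {n : ℕ} (G : Graph n) : Set where
  field
    verts : Subset n
    edges : Fin n → Fin n → Bool
    edges-sym : ∀ u v → edges u v ≡ true → edges v u ≡ true
    edges-⊆   : ∀ u v → edges u v ≡ true → adj G u v ≡ true
    edges-in  : ∀ u v → edges u v ≡ true → (u ∈ verts) × (v ∈ verts)
open Subgraph public

SubConnected : ∀ {n} {G : Graph n} → Subgraph G → Set
SubConnected H = ∀ u v → u ∈ verts H → v ∈ verts H → Walk (edges H) u v

SteinerWitness : ∀ {n} → Graph n → Subset n → ℕ → Set
SteinerWitness G S d =
  Σ (Subgraph G) λ H → SubConnected H × (S ⊆ verts H) × (edgeCount (edges H) ≡ d)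

IsSteinerDist : ∀ {n} → Graph n → Subset n → ℕ → Set
IsSteinerDist G S d =
  SteinerWitness G S d × (∀ d' → SteinerWitness G S d' → d ≤ d')

-- e = ε_{k,k'}(S';G) = max { d_G(S) : S' ⊆ S, |S| = k }.
IsSteinerEcc : ∀ {n} → Graph n → ℕ → Subset n → ℕ → Set
IsSteinerEcc G k S' e =
  (Σ _ λ S → S' ⊆ S × ∣ S ∣ ≡ k × IsSteinerDist G S e)
  × (∀ S d → S' ⊆ S → ∣ S ∣ ≡ k → IsSteinerDist G S d → d ≤ e)

⁅_⁆ : ∀ {n} → Fin n → Subset n
⁅_⁆ = Data.Fin.Subset.⁅_⁆

-- D = Sd_k(G) = max_v ε_k(v;G), where ε_k(v;G) = ε_{k,1}({v};G).
IsSteinerDiam : ∀ {n} → Graph n → ℕ → ℕ → Set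
IsSteinerDiam G k D =
  (Σ _ λ v → IsSteinerEcc G k ⁅ v ⁆ D)
  × (∀ v e → IsSteinerEcc G k ⁅ v ⁆ e → e ≤ D)

-- R = Sr_{k,k'}(G) = min { ε_{k,k'}(S';G) : |S'| = k' }.
IsSteinerRad : ∀ {n} → Graph n → ℕ → ℕ → ℕ → Set
IsSteinerRad G k k' R =
  (Σ _ λ S' → ∣ S' ∣ ≡ k' × IsSteinerEcc G k S' R)
  × (∀ S' e → ∣ S' ∣ ≡ k' → IsSteinerEcc G k S' e → R ≤ e)

-- Let S₀ be a (k − k')-set attaining Sd_{k−k'}(T) and S' a k'-set attaining Sr_{k,k'}(T).
-- S₀ ∪ S' has at most k vertices, so it extends to a k-set S ⊇ S'. Steiner distance is
-- monotone under inclusion, hence Sd_{k−k'}(T) = d(S₀) ≤ d(S) ≤ ε_{k,k'}(S') = Sr_{k,k'}(T).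
module Submission where

open import Defs
open import Data.Nat using (ℕ; _≤_; _+_; _∸_)
open import Data.Nat.Base using (zero; suc; s≤s; z≤n; _<_)
open import Data.Nat.Properties
open import Data.Nat.Induction using (<-rec)
open import Data.Bool using (true; false)
open import Data.Vec using ([]; _∷_)
open import Data.Fin.Subset using (Subset; _∪_; _⊆_; ⊤; ∣_∣)
open import Data.Fin.Subset.Properties
  using (∈⊤; ∣p∣≤∣x∷p∣; ∣⊤∣≡n; ⊆⊤; in⊆in; out⊆; p⊆p∪q; q⊆p∪q; ⊆-trans)
open import Data.Product using (∃; _×_; _,_)
open import Function using (_∘_)
open import Relation.Nullary using (¬_; yes; no)
open import Relation.Nullary.Negation using (¬¬-map; contradiction)
open import Relation.Nullary.Decidable using (decidable-stable)
open import Relation.Binary.PropositionalEquality using (_≡_; refl; cong; cong₂; trans)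
  renaming (sym to ≡-sym)

∣p∪q∣≤∣p∣+∣q∣ : ∀ {n} (p q : Subset n) → ∣ p ∪ q ∣ ≤ ∣ p ∣ + ∣ q ∣
∣p∪q∣≤∣p∣+∣q∣ [] [] = z≤n
∣p∪q∣≤∣p∣+∣q∣ (true ∷ p) (t ∷ q) =
  s≤s (≤-trans (∣p∪q∣≤∣p∣+∣q∣ p q) (+-monoʳ-≤ ∣ p ∣ (∣p∣≤∣x∷p∣ t q)))
∣p∪q∣≤∣p∣+∣q∣ (false ∷ p) (true ∷ q) =
  ≤-trans (s≤s (∣p∪q∣≤∣p∣+∣q∣ p q)) (≤-reflexive (≡-sym (+-suc ∣ p ∣ ∣ q ∣)))
∣p∪q∣≤∣p∣+∣q∣ (false ∷ p) (false ∷ q) = ∣p∪q∣≤∣p∣+∣q∣ p q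

superset-of-size : ∀ {n} (p : Subset n) {k} → ∣ p ∣ ≤ k → k ≤ n →
                   ∃ λ q → p ⊆ q × ∣ q ∣ ≡ k
superset-of-size [] {zero} _ _ = [] , (λ ()) , refl
superset-of-size (true ∷ p) {suc k} (s≤s ∣p∣≤k) (s≤s k≤n)
  with q , p⊆q , ∣q∣≡k ← superset-of-size p ∣p∣≤k k≤n =
  true ∷ q , in⊆in p⊆q , cong suc ∣q∣≡k
superset-of-size {suc n} (false ∷ p) {k} ∣p∣≤k k≤1+n with k ≤? n
... | yes k≤n with q , p⊆q , ∣q∣≡k ← superset-of-size p ∣p∣≤k k≤n =
  false ∷ q , out⊆ p⊆q , ∣q∣≡k
... | no k≰n = ⊤ , ⊆⊤ , trans (∣⊤∣≡n (suc n)) (≤-antisym (≰⇒> k≰n) k≤1+n)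

¬¬-least : (P : ℕ → Set) {m : ℕ} → P m → ¬ ¬ (∃ λ d → P d × (∀ d' → P d' → d ≤ d'))
¬¬-least P {m} Pm noLeast = <-rec (λ m → ¬ P m) notBelow m Pm
  where
  notBelow : ∀ m → (∀ {j} → j < m → ¬ P j) → ¬ P m
  notBelow m ¬P<m Pm = noLeast (m , Pm , least)
    where
    least : ∀ d' → P d' → m ≤ d'
    least d' Pd' with m ≤? d'
    ... | yes m≤d' = m≤d'
    ... | no m≰d' = contradiction Pd' (¬P<m (≰⇒> m≰d'))

steinerWitness-⊆ : ∀ {n} {G : Graph n} {S S' : Subset n} {d : ℕ} →
                   S ⊆ S' → SteinerWitness G S' d → SteinerWitness G S d
steinerWitness-⊆ S⊆S' (H , connected , S'⊆H , count) =
  H , connected , ⊆-trans S⊆S' S'⊆H , count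

connected⇒steinerWitness : ∀ {n} {G : Graph n} → Connected G → (S : Subset n) →
                           SteinerWitness G S (edgeCount (adj G))
connected⇒steinerWitness {G = G} connected S =
  whole , (λ u v _ _ → connected u v) , ⊆⊤ , refl
  where
  whole : Subgraph G
  whole = record { verts = ⊤ ; edges = adj G ; edges-sym = Graph.sym G
                 ; edges-⊆ = λ _ _ e → e ; edges-in = λ _ _ _ → ∈⊤ , ∈⊤ }

steinerDist-mono : ∀ {n} {G : Graph n} {S S' : Subset n} {d d' : ℕ} → S ⊆ S' →
                   IsSteinerDist G S d → IsSteinerDist G S' d' → d ≤ d'
steinerDist-mono S⊆S' (_ , least) (witness' , _) = least _ (steinerWitness-⊆ S⊆S' witness')

-- Existence of d_G(S) needs a least-number principle over an undecidable predicate,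
-- so it only holds up to double negation; this suffices because _≤_ is decidable.
¬¬-steinerDist : ∀ {n} {G : Graph n} → Connected G → (S : Subset n) →
                 ¬ ¬ ∃ (IsSteinerDist G S)
¬¬-steinerDist connected S = ¬¬-least _ (connected⇒steinerWitness connected S)

theorem3p3 : (n k k' : ℕ) → k ≤ n → 3 ≤ k → 1 ≤ k' → 2 ≤ k ∸ k' →
    (T : Graph n) → IsTree T →
    (D R : ℕ) → IsSteinerDiam T (k ∸ k') D → IsSteinerRad T k k' R →
    D ≤ R
theorem3p3 n k k' k≤n _ _ 2≤k∸k' T (connected , _) D R
  ((_ , (S₀ , _ , ∣S₀∣≡k∸k' , dS₀≡D) , _) , _) ((S' , ∣S'∣≡k' , _ , eccS'≤R) , _) =
  viaSuperset (superset-of-size (S₀ ∪ S') ∣S₀∪S'∣≤k k≤n)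
  where
  k'≤k : k' ≤ k
  k'≤k = <⇒≤ (m∸n≢0⇒n<m (λ k∸k'≡0 → contradiction (≤-trans 2≤k∸k' (≤-reflexive k∸k'≡0)) λ ()))

  ∣S₀∪S'∣≤k : ∣ S₀ ∪ S' ∣ ≤ k
  ∣S₀∪S'∣≤k = begin
    ∣ S₀ ∪ S' ∣     ≤⟨ ∣p∪q∣≤∣p∣+∣q∣ S₀ S' ⟩
    ∣ S₀ ∣ + ∣ S' ∣ ≡⟨ cong₂ _+_ ∣S₀∣≡k∸k' ∣S'∣≡k' ⟩
    (k ∸ k') + k'   ≡⟨ m∸n+n≡m k'≤k ⟩
    k               ∎
    where open ≤-Reasoning

  viaSuperset : (∃ λ S → S₀ ∪ S' ⊆ S × ∣ S ∣ ≡ k) → D ≤ R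
  viaSuperset (S , S₀∪S'⊆S , ∣S∣≡k) =
    decidable-stable (D ≤? R) (¬¬-map D≤R (¬¬-steinerDist connected S))
    where
    D≤R : ∃ (IsSteinerDist T S) → D ≤ R
    D≤R (d , dS≡d) =
      ≤-trans (steinerDist-mono (S₀∪S'⊆S ∘ p⊆p∪q S') dS₀≡D dS≡d)
              (eccS'≤R S d (S₀∪S'⊆S ∘ q⊆p∪q S₀ S') ∣S∣≡k dS≡d)
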